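{- If two states $X,Y\in\mathbb{F}_2^n$ are not comparable in the componentwise order, then $\vartheta_0(X)\cap\vartheta_0(Y)=\varnothing$.
   Context: $\mathbb{F}_2^n$ is ordered componentwise with $0<1$. A permutation $\sigma$ of $\{1,\dots,n\}$, written in one-line notation $\sigma_1\cdots\sigma_n$ (so $\sigma(i)=\sigma_i$), acts on $X=[x_1,\dots,x_n]$ by $\sigma\cdot X=[x_{\sigma^{ -1}(1)},\dots,x_{\sigma^{ -1}(n)}]$. For $0\le k\le n$, $S_{0,k}$ is the state with $x_i=0$ for $i\le k$ and $x_i=1$ for $i>k$. $\vartheta_0(X)=\{\pi:\pi^{ -1}\cdot X=S_{0,k}\text{ for some }k\}$. -}

module Defs where

open import Data.Nat using (ℕ; _<_; _≤_)
open import Data.Bool using (Bool; true; false; if_then_else_)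
import Data.Bool as B
open import Data.Fin using (Fin; toℕ)
open import Data.Fin.Permutation using (Permutation′; _⟨$⟩ˡ_; flip)
open import Data.Product using (Σ; ∃; _×_)
open import Data.Sum using (_⊎_)
open import Relation.Nullary using (¬_)
open import Relation.Nullary.Decidable using (⌊_⌋)
open import Relation.Binary.PropositionalEquality using (_≡_)
import Data.Nat as N

-- A state in F_2^n: bits indexed by Fin n (Fin index i ↔ position i+1), 0 = false, 1 = true.
State : ℕ → Set
State n = Fin n → Bool

_≼_ : ∀ {n} → State n → State n → Set
X ≼ Y = ∀ i → X i B.≤ Y i

Comparable : ∀ {n} → State n → State n → Set
Comparable X Y = X ≼ Y ⊎ Y ≼ X

-- σ · X = [x_{σ⁻¹(1)}, …, x_{σ⁻¹(n)}]
act : ∀ {n} → Permutation′ n → State n → State n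
act σ X i = X (σ ⟨$⟩ˡ i)

-- S_{0,k}: x_i = 0 for positions i ≤ k (1-based), 1 otherwise.
-- Fin index j is 1-based position toℕ j + 1, so x = 0 iff toℕ j < k.
S0 : ∀ n → ℕ → State n
S0 n k j = if ⌊ toℕ j N.<? k ⌋ then false else true

ϑ₀ : ∀ {n} → State n → Permutation′ n → Set
ϑ₀ {n} X π = Σ ℕ λ k → (k ≤ n) × (∀ i → act (flip π) X i ≡ S0 n k i)

-- If π⁻¹·X = S_{0,k} and π⁻¹·Y = S_{0,k'}, then π⁻¹·X and π⁻¹·Y are comparable
-- because the states S_{0,k} form a chain, and the action of π⁻¹ reflects the
-- componentwise order; so X and Y are comparable.
module Submission where

open import Defs
open import Data.Nat using (ℕ)
open import Data.Fin.Permutation using (Permutation′)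
open import Data.Product using (_×_)
open import Relation.Nullary using (¬_)

import Data.Nat as ℕ
open import Data.Nat.Properties using (<-≤-trans; ≤-total)
open import Data.Fin using (toℕ)
open import Data.Fin.Permutation using (_⟨$⟩ʳ_; flip; inverseˡ)
import Data.Bool as Bool
open import Data.Empty using (⊥-elim)
open import Data.Sum using (inj₁; inj₂)
open import Data.Product using (_,_)
open import Relation.Nullary using (yes; no)
open import Relation.Binary.PropositionalEquality using (_≡_; sym; subst; subst₂)

S0-antitone : ∀ n {k k′} → k ℕ.≤ k′ → S0 n k′ ≼ S0 n k
S0-antitone n {k} {k′} k≤k′ i with toℕ i ℕ.<? k′ | toℕ i ℕ.<? k
... | yes _   | yes _   = Bool.b≤b
... | yes _   | no _    = Bool.f≤t
... | no i≮k′ | yes i<k = ⊥-elim (i≮k′ (<-≤-trans i<k k≤k′))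
... | no _    | no _    = Bool.b≤b

≼-respects-≗ : ∀ {n} {X X′ Y Y′ : State n} →
  (∀ i → X i ≡ X′ i) → (∀ i → Y i ≡ Y′ i) → X′ ≼ Y′ → X ≼ Y
≼-respects-≗ X≗X′ Y≗Y′ X′≼Y′ i = subst₂ Bool._≤_ (sym (X≗X′ i)) (sym (Y≗Y′ i)) (X′≼Y′ i)

act-reflects-≼ : ∀ {n} (σ : Permutation′ n) {X Y : State n} → act σ X ≼ act σ Y → X ≼ Y
act-reflects-≼ σ {X} {Y} σX≼σY j =
  subst (λ i → X i Bool.≤ Y i) (inverseˡ σ) (σX≼σY (σ ⟨$⟩ʳ j))

ϑ₀-common-comparable : ∀ {n} {X Y : State n} (π : Permutation′ n) →
  ϑ₀ X π → ϑ₀ Y π → Comparable X Y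
ϑ₀-common-comparable {n} π (k , _ , πX≗S0k) (k′ , _ , πY≗S0k′) with ≤-total k k′
... | inj₁ k≤k′ = inj₂ (act-reflects-≼ (flip π)
        (≼-respects-≗ πY≗S0k′ πX≗S0k (S0-antitone n k≤k′)))
... | inj₂ k′≤k = inj₁ (act-reflects-≼ (flip π)
        (≼-respects-≗ πX≗S0k πY≗S0k′ (S0-antitone n k′≤k)))

lemma3p13 : ∀ (n : ℕ) (X Y : State n) → ¬ Comparable X Y →
    ∀ (π : Permutation′ n) → ¬ (ϑ₀ X π × ϑ₀ Y π)
lemma3p13 n X Y incomparable π (π∈ϑ₀X , π∈ϑ₀Y) =
  incomparable (ϑ₀-common-comparable π π∈ϑ₀X π∈ϑ₀Y)
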